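{- Let $n>1$ be a natural number, $p$ any prime, and let $p_1,\dots,p_l$ be primes each of which is a $\varphi$-divisor (of any degree) of $2n$. Let $s,s_1,\dots,s_l$ be nonnegative integers. Then the equation $$x_1^{2n}+x_2^{2n}=(p^s\,p_1^{s_1}p_2^{s_2}\cdots p_l^{s_l})^{2n}$$ has no solution with $x_1,x_2\in\mathbb{N}$. In particular, for natural $n>1$ and nonnegative integers $s_1,s_2,s$, the equation $x_1^{2n}+x_2^{2n}=(2^{s_1}3^{s_2}p^s)^{2n}$ has no solution in positive integers.
   Context: $\varphi$ is Euler's totient function. For an even natural number $N$, a prime $q$ is called a $\varphi$-divisor of $N$ if there exists a natural number $k$ with $q^k\ge 3$ and $\varphi(q^k)\mid N$. $\mathbb{N}=\{1,2,\dots\}$. -}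

module Defs where

open import Data.Nat using (ℕ; zero; suc; _+_; _*_; _^_; _≥_)
open import Data.Nat.GCD using (gcd)
open import Data.Nat.Divisibility using (_∣_)
open import Data.Nat.Primality using (Prime)
open import Data.List using (List; filter; length; map; foldr)
open import Data.List.Base using (upTo)
open import Data.Nat using (_≟_)
open import Data.Product using (∃-syntax; _×_; proj₁; proj₂)

φ : ℕ → ℕ
φ N = length (filter (λ m → gcd m N ≟ 1) (map suc (upTo N)))

φ-divisor : ℕ → ℕ → Set
φ-divisor q N = Prime q × ∃[ k ] (k ≥ 1 × q ^ k ≥ 3 × φ (q ^ k) ∣ N)

prodPow : List (ℕ × ℕ) → ℕ
prodPow = foldr (λ ps acc → (proj₁ ps ^ proj₂ ps) * acc) 1

-- x^(2n) + y^(2n) = z^(2n) with n > 1 is Fermat's equation for the exponent 4 (when n is even) or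
-- for an odd prime exponent r dividing n. Dividing out common primes of x and y we may assume x, y
-- coprime; then no prime q with q - 1 ∣ 2n divides z, since by Fermat's little theorem x^(2n) and
-- y^(2n) are 1 modulo q (modulo 4 when q = 2) while their sum is 0. As φ(q^k) = q^(k-1)(q - 1),
-- every φ-divisor of 2n is such a prime, so z is a power of the one remaining prime p.
-- Exponent 4 is excluded by Fermat's descent on x⁴ + y⁴ = w². For an odd prime r write
-- X^r + Y^r = (X + Y) Q = Z^r with Z a power of p: both factors are powers of p, and a common
-- divisor of X + Y and Q divides r X^r, so p² ∤ Q, i.e. Q ≤ p; then Z^r = (X + Y) Q < 2Zp ≤ Z³.
module Submission where

open import Data.Empty using (⊥; ⊥-elim)
open import Data.List.Base using (List; []; _∷_; _++_; filter; length; map; upTo)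
open import Data.List.Properties using (filter-accept; filter-reject; filter-++; map-++; length-++; upTo-∷ʳ)
open import Data.List.Relation.Unary.All using (All; []; _∷_)
open import Data.Nat.Base
open import Data.Nat.DivMod using (_%_; _/_; m%n<n; m≡m%n+[m/n]*n)
open import Data.Nat.Divisibility
open import Data.Nat.GCD using (gcd; gcd[m,n]∣m; gcd[m,n]∣n; gcd[m,n]≡0⇒m≡0; gcd-greatest)
open import Data.Nat.Induction using (<-rec)
open import Data.Nat.ListAction using (product)
open import Data.Nat.Primality
open import Data.Nat.Primality.Factorisation using (factorise)
open import Data.Nat.Properties
open import Data.Nat.Tactic.RingSolver using (solve-∀)
open import Data.Product using (∃-syntax; _×_; _,_; proj₁; proj₂)
open import Data.Sum using (_⊎_; inj₁; inj₂; [_,_]′)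
open import Function.Base using (id; _∘_)
open import Relation.Binary.Definitions using (tri<; tri≈; tri>)
open import Relation.Binary.PropositionalEquality
open import Relation.Nullary using (¬_; yes; no; contradiction)
open import Relation.Nullary.Decidable using (from-yes)
open import Defs

*-positiveˡ : ∀ m {n} → 0 < m * n → 0 < m
*-positiveˡ (suc m) _ = z<s

*-positiveʳ : ∀ m {n} → 0 < m * n → 0 < n
*-positiveʳ m {n} mn>0 = *-positiveˡ n (subst (0 <_) (*-comm m n) mn>0)

*-self-injective : ∀ {a b} → a * a ≡ b * b → a ≡ b
*-self-injective {a} {b} aa≡bb with <-cmp a b
... | tri< a<b _ _ = contradiction aa≡bb (<⇒≢ (*-mono-< a<b a<b))
... | tri≈ _ a≡b _ = a≡b
... | tri> _ _ a>b = contradiction (sym aa≡bb) (<⇒≢ (*-mono-< a>b a>b))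

*-self-≤⇒≤ : ∀ {a b} → a * a ≤ b * b → a ≤ b
*-self-≤⇒≤ {a} {b} aa≤bb with a ≤? b
... | yes a≤b = a≤b
... | no  a≰b = contradiction (*-mono-< (≰⇒> a≰b) (≰⇒> a≰b)) (≤⇒≯ aa≤bb)

*-suc-pred : ∀ m n .{{_ : NonZero m}} → m * suc n ≡ suc (m * n + pred m)
*-suc-pred (suc m) n = trans (*-suc (suc m) n) (cong suc (+-comm m _))

^-distribʳ-* : ∀ a b k → (a * b) ^ k ≡ a ^ k * b ^ k
^-distribʳ-* a b zero    = refl
^-distribʳ-* a b (suc k) = trans (cong (a * b *_) (^-distribʳ-* a b k)) (regroup a b (a ^ k) (b ^ k))
  where
  regroup : ∀ a b A B → a * b * (A * B) ≡ a * A * (b * B)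
  regroup = solve-∀

^-double : ∀ x n → x ^ (2 * n) ≡ (x * x) ^ n
^-double x n = trans (sym (^-*-assoc x 2 n)) (cong (λ y → (x * y) ^ n) (*-identityʳ x))

∣⇒∣^ : ∀ {d} a k → .{{NonZero k}} → d ∣ a → d ∣ a ^ k
∣⇒∣^ a (suc k) d∣a = ∣m⇒∣m*n (a ^ k) d∣a

¬2∣⇒odd : ∀ x → ¬ 2 ∣ x → ∃[ a ] x ≡ 1 + 2 * a
¬2∣⇒odd x 2∤x with x % 2 | m%n<n x 2 | m≡m%n+[m/n]*n x 2
... | 0    | _            | x≡ = contradiction (divides (x / 2) x≡) 2∤x
... | 1    | _            | x≡ = x / 2 , trans x≡ (cong suc (*-comm (x / 2) 2))
... | 2+ _ | s<s (s<s ()) | _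

prime⇒>1 : ∀ {p} → Prime p → 1 < p
prime⇒>1 {p} pp = nonTrivial⇒n>1 p {{prime⇒nonTrivial pp}}

prime⇒>0 : ∀ {p} → Prime p → 0 < p
prime⇒>0 pp = <-trans z<s (prime⇒>1 pp)

prime[3] : Prime 3
prime[3] = from-yes (prime? 3)

∃-prime-factor : ∀ {n} → 1 < n → ∃[ q ] Prime q × q ∣ n
∃-prime-factor {n} 1<n with factorise n {{>-nonZero (<-trans z<s 1<n)}}
... | record { factors = [] ; isFactorisation = n≡1 } = contradiction n≡1 (>⇒≢ 1<n)
... | record { factors = q ∷ qs ; isFactorisation = n≡q*qs ; factorsPrime = pq ∷ _ } =
  q , pq , divides (product qs) (trans n≡q*qs (*-comm q (product qs)))

prime∣^⇒prime∣ : ∀ {p} a k → Prime p → p ∣ a ^ k → p ∣ a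
prime∣^⇒prime∣ a zero    pp p∣1    = contradiction (∣1⇒≡1 p∣1) (>⇒≢ (prime⇒>1 pp))
prime∣^⇒prime∣ a (suc k) pp p∣aᵏ⁺¹ with euclidsLemma a (a ^ k) pp p∣aᵏ⁺¹
... | inj₁ p∣a  = p∣a
... | inj₂ p∣aᵏ = prime∣^⇒prime∣ a k pp p∣aᵏ

prime∣m*m⇒prime∣m : ∀ {p} m → Prime p → p ∣ m * m → p ∣ m
prime∣m*m⇒prime∣m m pp p∣mm = [ id , id ]′ (euclidsLemma m m pp p∣mm)

prime∣prime⇒≡ : ∀ {p q} → Prime q → Prime p → q ∣ p → q ≡ p
prime∣prime⇒≡ pq pp q∣p with prime⇒irreducible pp q∣p
... | inj₁ refl = contradiction (prime⇒>1 pq) (<-irrefl refl)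
... | inj₂ q≡p  = q≡p

prime∣prime^⇒≡ : ∀ {p q} s → Prime p → Prime q → q ∣ p ^ s → q ≡ p
prime∣prime^⇒≡ {p} s pp pq q∣pˢ = prime∣prime⇒≡ pq pp (prime∣^⇒prime∣ p s pq q∣pˢ)

OnlyPrimeFactor : ℕ → ℕ → Set
OnlyPrimeFactor p n = ∀ q → Prime q → q ∣ n → q ≡ p

product≡^length : ∀ {p} qs → All Prime qs → OnlyPrimeFactor p (product qs) → product qs ≡ p ^ length qs
product≡^length []       []         _    = refl
product≡^length (q ∷ qs) (pq ∷ pqs) only = cong₂ _*_ (only q pq (m∣m*n (product qs)))
  (product≡^length qs pqs (λ r pr r∣qs → only r pr (∣n⇒∣m*n q r∣qs)))

onlyPrimeFactor⇒power : ∀ {p n} → .{{NonZero n}} → OnlyPrimeFactor p n → ∃[ j ] n ≡ p ^ j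
onlyPrimeFactor⇒power {p} {n} only with factorise n
... | record { factors = qs ; isFactorisation = n≡∏qs ; factorsPrime = pqs } =
  length qs , trans n≡∏qs (product≡^length qs pqs (λ q pq q∣∏ → only q pq (subst (q ∣_) (sym n≡∏qs) q∣∏)))

∣prime^⇒≤∨square∣ : ∀ {p d} m → .{{NonZero d}} → Prime p → d ∣ p ^ m → d ≤ p ⊎ p * p ∣ d
∣prime^⇒≤∨square∣ {p} m pp d∣pᵐ with onlyPrimeFactor⇒power (λ q pq q∣d → prime∣prime^⇒≡ m pp pq (∣-trans q∣d d∣pᵐ))
... | 0    , refl = inj₁ (<⇒≤ (prime⇒>1 pp))
... | 1    , refl = inj₁ (≤-reflexive (*-identityʳ p))
... | 2+ j , refl = inj₂ (divides (p ^ j) (regroup p (p ^ j)))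
  where
  regroup : ∀ p P → p * (p * P) ≡ P * (p * p)
  regroup = solve-∀

NoCommonPrime : ℕ → ℕ → Set
NoCommonPrime a b = ∀ q → Prime q → q ∣ a → q ∣ b → ⊥

gcd≢1⇒common-prime : ∀ {m n} → 0 < m → gcd m n ≢ 1 → ∃[ q ] Prime q × q ∣ m × q ∣ n
gcd≢1⇒common-prime {m} {n} m>0 g≢1 with gcd m n in g≡
... | 0    = contradiction (gcd[m,n]≡0⇒m≡0 g≡) (>⇒≢ m>0)
... | 1    = contradiction refl g≢1
... | 2+ g with ∃-prime-factor {2+ g} (s<s z<s)
...   | q , pq , q∣g = q , pq , ∣-trans q∣gcd (gcd[m,n]∣m m n) , ∣-trans q∣gcd (gcd[m,n]∣n m n)
  where q∣gcd = subst (q ∣_) (sym g≡) q∣g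

noCommonPrime-or-commonPrime : ∀ a b → 0 < a → NoCommonPrime a b ⊎ ∃[ q ] Prime q × q ∣ a × q ∣ b
noCommonPrime-or-commonPrime a b a>0 with gcd a b ≟ 1
... | yes g≡1 = inj₁ λ q pq q∣a q∣b → contradiction (subst (q ∣_) g≡1 (gcd-greatest q∣a q∣b)) (>⇒∤ (prime⇒>1 pq))
... | no  g≢1 = inj₂ (gcd≢1⇒common-prime a>0 g≢1)

NoCommonPrime-sym : ∀ {a b} → NoCommonPrime a b → NoCommonPrime b a
NoCommonPrime-sym a⊥b q pq q∣b q∣a = a⊥b q pq q∣a q∣b

NoCommonPrime-∣ˡ : ∀ {a b d} → d ∣ a → NoCommonPrime a b → NoCommonPrime d b
NoCommonPrime-∣ˡ d∣a a⊥b q pq q∣d q∣b = a⊥b q pq (∣-trans q∣d d∣a) q∣b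

NoCommonPrime-^ : ∀ {a b} k → NoCommonPrime a b → NoCommonPrime (a ^ k) (b ^ k)
NoCommonPrime-^ {a} {b} k a⊥b q pq q∣aᵏ q∣bᵏ = a⊥b q pq (prime∣^⇒prime∣ a k pq q∣aᵏ) (prime∣^⇒prime∣ b k pq q∣bᵏ)

NoCommonPrime-*-self : ∀ {a b} → NoCommonPrime a b → NoCommonPrime (a * a) (b * b)
NoCommonPrime-*-self {a} {b} a⊥b q pq q∣aa q∣bb = a⊥b q pq (prime∣m*m⇒prime∣m a pq q∣aa) (prime∣m*m⇒prime∣m b pq q∣bb)

NoCommonPrime-*-self⁻ : ∀ {a b} → NoCommonPrime (a * a) (b * b) → NoCommonPrime a b
NoCommonPrime-*-self⁻ {a} {b} aa⊥bb q pq q∣a q∣b = aa⊥bb q pq (∣m⇒∣m*n a q∣a) (∣m⇒∣m*n b q∣b)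

-- Fermat's little theorem

infixl 7 _choose_
_choose_ : ℕ → ℕ → ℕ
n     choose zero  = 1
zero  choose suc k = 0
suc n choose suc k = n choose k + n choose suc k

choose-> : ∀ {n k} → n < k → n choose k ≡ 0
choose-> {zero}  {suc k} _         = refl
choose-> {suc n} {suc k} (s<s n<k) = cong₂ _+_ (choose-> n<k) (choose-> (m<n⇒m<1+n n<k))

choose-diag : ∀ n → n choose n ≡ 1
choose-diag zero    = refl
choose-diag (suc n) = cong₂ _+_ (choose-diag n) (choose-> (n<1+n n))

choose-1 : ∀ n → n choose 1 ≡ n
choose-1 zero    = refl
choose-1 (suc n) = cong suc (choose-1 n)

choose-absorption : ∀ n k → suc k * (suc n choose suc k) ≡ suc n * (n choose k)
choose-absorption n zero = begin
  1 * (suc n choose 1)  ≡⟨ *-identityˡ _ ⟩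
  suc n choose 1        ≡⟨ choose-1 (suc n) ⟩
  suc n                 ≡⟨ *-identityʳ (suc n) ⟨
  suc n * 1             ∎
  where open ≡-Reasoning
choose-absorption zero    (suc k) = *-zeroʳ (2 + k)
choose-absorption (suc n) (suc k) = begin
  (2 + k) * (B + C)                                    ≡⟨ split (suc k) B C ⟩
  B + suc k * B + (2 + k) * C                          ≡⟨ cong₂ (λ u v → B + u + v) (choose-absorption n k) (choose-absorption n (suc k)) ⟩
  B + suc n * (n choose k) + suc n * (n choose suc k)  ≡⟨ merge (suc n) (n choose k) (n choose suc k) ⟩
  (2 + n) * B                                          ∎
  where
  open ≡-Reasoning
  B = suc n choose suc k
  C = suc n choose (2 + k)
  split : ∀ s B C → suc s * (B + C) ≡ B + s * B + suc s * C
  split = solve-∀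
  merge : ∀ m u v → (u + v) + m * u + m * v ≡ suc m * (u + v)
  merge = solve-∀

prime∣choose : ∀ {p} → Prime p → ∀ j → 0 < j → j < p → p ∣ p choose j
prime∣choose {suc m} pp (suc i) _ j<p
  with euclidsLemma (suc i) (suc m choose suc i) pp
         (divides (m choose i) (trans (choose-absorption m i) (*-comm (suc m) (m choose i))))
... | inj₁ p∣j = contradiction (∣⇒≤ p∣j) (<⇒≱ j<p)
... | inj₂ p∣C = p∣C

binomialSum : ℕ → ℕ → ℕ → ℕ
binomialSum n a zero    = 0
binomialSum n a (suc j) = binomialSum n a j + n choose j * a ^ j

binomialSum-suc : ∀ n a j → binomialSum (suc n) a (suc j) ≡ binomialSum n a (suc j) + a * binomialSum n a j
binomialSum-suc n a zero    = cong (1 * 1 +_) (sym (*-zeroʳ a))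
binomialSum-suc n a (suc j) = begin
  S′ (suc j) + (n choose j + n choose suc j) * (a * a ^ j)        ≡⟨ cong (_+ (n choose j + n choose suc j) * (a * a ^ j)) (binomialSum-suc n a j) ⟩
  S (suc j) + a * S j + (n choose j + n choose suc j) * (a * a ^ j) ≡⟨ regroup (S j) (n choose j) (n choose suc j) a (a ^ j) ⟩
  S (suc j) + n choose suc j * (a * a ^ j) + a * S (suc j)          ∎
  where
  open ≡-Reasoning
  S  = binomialSum n a
  S′ = binomialSum (suc n) a
  regroup : ∀ s b c a e → s + b * e + a * s + (b + c) * (a * e) ≡ s + b * e + c * (a * e) + a * (s + b * e)
  regroup = solve-∀

binomial-theorem : ∀ n a → suc a ^ n ≡ binomialSum n a (suc n)
binomial-theorem zero    a = refl
binomial-theorem (suc n) a = begin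
  suc a * suc a ^ n                            ≡⟨ cong (suc a *_) (binomial-theorem n a) ⟩
  suc a * S (suc n)                            ≡⟨ expand (S (suc n)) a (a * a ^ n) ⟩
  S (suc n) + 0 * (a * a ^ n) + a * S (suc n)  ≡⟨ cong (λ c → S (suc n) + c * (a * a ^ n) + a * S (suc n)) (choose-> (n<1+n n)) ⟨
  S (2 + n) + a * S (suc n)                    ≡⟨ binomialSum-suc n a (suc n) ⟨
  binomialSum (suc n) a (2 + n)                ∎
  where
  open ≡-Reasoning
  S = binomialSum n a
  expand : ∀ s a e → suc a * s ≡ s + 0 * e + a * s
  expand = solve-∀

infix 4 _≡1-mod_
_≡1-mod_ : ℕ → ℕ → Set
y ≡1-mod m = ∃[ w ] y ≡ 1 + m * w

≡1-mod-^ : ∀ {m y} t → y ≡1-mod m → y ^ t ≡1-mod m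
≡1-mod-^ {m} zero    _        = 0 , cong suc (sym (*-zeroʳ m))
≡1-mod-^ {m} (suc t) (w , y≡) with ≡1-mod-^ {m} t (w , y≡)
... | w′ , yᵗ≡ = w + w′ + m * w * w′ , trans (cong₂ _*_ y≡ yᵗ≡) (multiply m w w′)
  where
  multiply : ∀ m w w′ → (1 + m * w) * (1 + m * w′) ≡ 1 + m * (w + w′ + m * w * w′)
  multiply = solve-∀

≡1-mod-+⇒∣2 : ∀ {m A B} → A ≡1-mod m → B ≡1-mod m → m ∣ A + B → m ∣ 2
≡1-mod-+⇒∣2 {m} (w , refl) (w′ , refl) m∣A+B = ∣m+n∣m⇒∣n (subst (m ∣_) (regroup m w w′) m∣A+B) (m∣m*n (w + w′))
  where
  regroup : ∀ m w w′ → 1 + m * w + (1 + m * w′) ≡ m * (w + w′) + 2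
  regroup = solve-∀

binomialSum-prime≡1-mod : ∀ {p} → Prime p → ∀ a j → 0 < j → j ≤ p → binomialSum p a j ≡1-mod p
binomialSum-prime≡1-mod {p} pp a 1 _ _ = 0 , cong suc (sym (*-zeroʳ p))
binomialSum-prime≡1-mod {p} pp a (2+ i) _ j≤p
  with binomialSum-prime≡1-mod pp a (suc i) z<s (≤-trans (n≤1+n _) j≤p) | prime∣choose pp (suc i) z<s j≤p
... | M , S≡ | divides c C≡ = M + c * a ^ suc i , (begin
  binomialSum p a (suc i) + p choose suc i * a ^ suc i  ≡⟨ cong₂ (λ u v → u + v * a ^ suc i) S≡ C≡ ⟩
  1 + p * M + c * p * a ^ suc i                         ≡⟨ collect p M c (a ^ suc i) ⟩
  1 + p * (M + c * a ^ suc i)                           ∎)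
  where
  open ≡-Reasoning
  collect : ∀ p M c e → 1 + p * M + c * p * e ≡ 1 + p * (M + c * e)
  collect = solve-∀

fermat : ∀ {p} → Prime p → ∀ a → ∃[ c ] a ^ p ≡ a + p * c
fermat {p@(suc _)} pp zero    = 0 , sym (*-zeroʳ p)
fermat {p@(suc _)} pp (suc a) with fermat pp a | binomialSum-prime≡1-mod pp a p z<s ≤-refl
... | c , aᵖ≡ | M , S≡ = M + c , (begin
  suc a ^ p                               ≡⟨ binomial-theorem p a ⟩
  binomialSum p a p + p choose p * a ^ p  ≡⟨ cong₂ (λ u v → u + v * a ^ p) S≡ (choose-diag p) ⟩
  1 + p * M + 1 * a ^ p                   ≡⟨ cong (λ u → 1 + p * M + 1 * u) aᵖ≡ ⟩
  1 + p * M + 1 * (a + p * c)             ≡⟨ collect p M a c ⟩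
  suc a + p * (M + c)                     ∎)
  where
  open ≡-Reasoning
  collect : ∀ p M a c → 1 + p * M + 1 * (a + p * c) ≡ suc a + p * (M + c)
  collect = solve-∀

fermat-∤ : ∀ {p} → Prime p → ∀ a → ¬ p ∣ a → a ^ (p ∸ 1) ≡1-mod p
fermat-∤ {p@(suc m)} pp a p∤a with a ^ m in aᵐ≡ | fermat pp a
... | zero  | _ = contradiction (subst (p ∣_) (sym (m^n≡0⇒m≡0 a m aᵐ≡)) (p ∣0)) p∤a
... | suc w | c , aᵖ≡ with euclidsLemma a w pp (divides c (trans a*w≡ (*-comm p c)))
  where
  a*w≡ : a * w ≡ p * c
  a*w≡ = +-cancelˡ-≡ a (a * w) (p * c) (trans (sym (*-suc a w)) aᵖ≡)
...   | inj₁ p∣a            = contradiction p∣a p∤a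
...   | inj₂ (divides v w≡) = v , cong suc (trans w≡ (*-comm v p))

-- Euler's totient of a prime power

module _ {q : ℕ} (pq : Prime q) (k : ℕ) where

  private
    Coprime? = λ m → gcd m (q ^ suc k) ≟ 1

    coprime⇒∤ : ∀ {m} → gcd m (q ^ suc k) ≡ 1 → ¬ q ∣ m
    coprime⇒∤ g≡1 q∣m = >⇒∤ (prime⇒>1 pq) (subst (q ∣_) g≡1 (gcd-greatest q∣m (m∣m*n (q ^ k))))

    ∤⇒coprime : ∀ {m} → 0 < m → ¬ q ∣ m → gcd m (q ^ suc k) ≡ 1
    ∤⇒coprime {m} m>0 q∤m with gcd m (q ^ suc k) ≟ 1
    ... | yes g≡1 = g≡1
    ... | no  g≢1 with gcd≢1⇒common-prime m>0 g≢1
    ...   | r , pr , r∣m , r∣qᵏ⁺¹ = contradiction (subst (_∣ m) (prime∣prime^⇒≡ (suc k) pq pr r∣qᵏ⁺¹) r∣m) q∤m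

    count : ℕ → ℕ
    count N = length (filter Coprime? (map suc (upTo N)))

    count-suc : ∀ N → count (suc N) ≡ count N + length (filter Coprime? (suc N ∷ []))
    count-suc N = begin
      length (filter Coprime? (map suc (upTo (suc N))))                          ≡⟨ cong (λ l → length (filter Coprime? (map suc l))) (upTo-∷ʳ N) ⟨
      length (filter Coprime? (map suc (upTo N ++ N ∷ [])))                      ≡⟨ cong (length ∘ filter Coprime?) (map-++ suc (upTo N) (N ∷ [])) ⟩
      length (filter Coprime? (map suc (upTo N) ++ suc N ∷ []))                  ≡⟨ cong length (filter-++ Coprime? (map suc (upTo N)) (suc N ∷ [])) ⟩
      length (filter Coprime? (map suc (upTo N)) ++ filter Coprime? (suc N ∷ [])) ≡⟨ length-++ (filter Coprime? (map suc (upTo N))) ⟩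
      count N + length (filter Coprime? (suc N ∷ []))                            ∎
      where open ≡-Reasoning

    count-suc-∤ : ∀ N → ¬ q ∣ suc N → count (suc N) ≡ count N + 1
    count-suc-∤ N q∤ = trans (count-suc N)
      (cong (λ (l : List ℕ) → count N + length l) (filter-accept Coprime? {x = suc N} {xs = []} (∤⇒coprime z<s q∤)))

    count-suc-∣ : ∀ N → q ∣ suc N → count (suc N) ≡ count N
    count-suc-∣ N q∣ = trans (count-suc N) (trans
      (cong (λ (l : List ℕ) → count N + length l) (filter-reject Coprime? {x = suc N} {xs = []} (λ g≡1 → coprime⇒∤ g≡1 q∣)))
      (+-identityʳ (count N)))

    count-block : ∀ j i → i < q → count (q * j + i) ≡ count (q * j) + i
    count-block j zero    _   = trans (cong count (+-identityʳ (q * j))) (sym (+-identityʳ _))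
    count-block j (suc i) i<q = begin
      count (q * j + suc i)    ≡⟨ cong count (+-suc (q * j) i) ⟩
      count (suc (q * j + i))  ≡⟨ count-suc-∤ (q * j + i) q∤ ⟩
      count (q * j + i) + 1    ≡⟨ cong (_+ 1) (count-block j i (<-trans (n<1+n i) i<q)) ⟩
      count (q * j) + i + 1    ≡⟨ trans (+-assoc _ i 1) (cong (count (q * j) +_) (+-comm i 1)) ⟩
      count (q * j) + suc i    ∎
      where
      open ≡-Reasoning
      q∤ : ¬ q ∣ suc (q * j + i)
      q∤ q∣ = >⇒∤ i<q (∣m+n∣m⇒∣n (subst (q ∣_) (sym (+-suc (q * j) i)) q∣) (m∣m*n j))

    count-multiple : ∀ j → count (q * j) ≡ j * (q ∸ 1)
    count-multiple zero    = cong count (*-zeroʳ q)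
    count-multiple (suc j) = begin
      count (q * suc j)              ≡⟨ cong count q*suc ⟩
      count (suc (q * j + (q ∸ 1)))  ≡⟨ count-suc-∣ _ (divides (suc j) (trans (sym q*suc) (*-comm q (suc j)))) ⟩
      count (q * j + (q ∸ 1))        ≡⟨ count-block j (q ∸ 1) (∸-monoʳ-< z<s (<⇒≤ (prime⇒>1 pq))) ⟩
      count (q * j) + (q ∸ 1)        ≡⟨ cong (_+ (q ∸ 1)) (count-multiple j) ⟩
      j * (q ∸ 1) + (q ∸ 1)          ≡⟨ +-comm (j * (q ∸ 1)) (q ∸ 1) ⟩
      suc j * (q ∸ 1)                ∎
      where
      open ≡-Reasoning
      q*suc : q * suc j ≡ suc (q * j + (q ∸ 1))
      q*suc = *-suc-pred q j {{prime⇒nonZero pq}}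

  φ[prime^suc] : φ (q ^ suc k) ≡ q ^ k * (q ∸ 1)
  φ[prime^suc] = count-multiple (q ^ k)

φ-divisor⇒pred∣ : ∀ {q N} → φ-divisor q N → (q ∸ 1) ∣ N
φ-divisor⇒pred∣ (_ , zero , () , _)
φ-divisor⇒pred∣ {q} (pq , suc k , _ , _ , φ∣N) = ∣-trans (divides (q ^ k) (φ[prime^suc] pq k)) φ∣N

prime∣z⇒∤x : ∀ {e x y z q} .{{_ : NonZero e}} → NoCommonPrime x y → x ^ e + y ^ e ≡ z ^ e →
             Prime q → q ∣ z → ¬ q ∣ x
prime∣z⇒∤x {e} {x} {y} x⊥y sol pq q∣z q∣x = x⊥y _ pq q∣x (prime∣^⇒prime∣ y e pq
  (∣m+n∣m⇒∣n (subst (_ ∣_) (sym sol) (∣⇒∣^ _ e q∣z)) (∣⇒∣^ x e q∣x)))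

odd*odd≡1-mod-4 : ∀ x → ¬ 2 ∣ x → x * x ≡1-mod 4
odd*odd≡1-mod-4 x 2∤x with ¬2∣⇒odd x 2∤x
... | a , refl = a * a + a , square a
  where
  square : ∀ a → (1 + 2 * a) * (1 + 2 * a) ≡ 1 + 4 * (a * a + a)
  square = solve-∀

-- For q = 2 Fermat only gives x^(2n) ≡ 1 mod 2, which is why we work modulo 4 instead.
pred∣2n⇒∤z : ∀ {n x y z q} .{{_ : NonZero n}} → NoCommonPrime x y →
             x ^ (2 * n) + y ^ (2 * n) ≡ z ^ (2 * n) → Prime q → (q ∸ 1) ∣ 2 * n → ¬ q ∣ z
pred∣2n⇒∤z {n} {x} {y} {z} {q} x⊥y sol pq q-1∣2n q∣z with q ≟ 2
... | yes refl = >⇒∤ (s<s (s<s z<s)) (≡1-mod-+⇒∣2 (one x 2∤x) (one y 2∤y) 4∣sum)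
  where
  instance _ = m*n≢0 2 n
  2∤x = prime∣z⇒∤x {2 * n} x⊥y sol prime[2] q∣z
  2∤y = prime∣z⇒∤x {2 * n} (NoCommonPrime-sym x⊥y) (trans (+-comm (y ^ (2 * n)) (x ^ (2 * n))) sol) prime[2] q∣z
  one : ∀ w → ¬ 2 ∣ w → w ^ (2 * n) ≡1-mod 4
  one w 2∤w = subst (_≡1-mod 4) (sym (^-double w n)) (≡1-mod-^ {4} n (odd*odd≡1-mod-4 w 2∤w))
  4∣sum : 4 ∣ x ^ (2 * n) + y ^ (2 * n)
  4∣sum = subst (4 ∣_) (sym (trans sol (^-double z n))) (∣⇒∣^ (z * z) n (*-pres-∣ q∣z q∣z))
... | no q≢2 = q≢2 (≤-antisym (∣⇒≤ q∣2) (prime⇒>1 pq))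
  where
  instance _ = m*n≢0 2 n
  t = quotient q-1∣2n
  one : ∀ w → ¬ q ∣ w → w ^ (2 * n) ≡1-mod q
  one w q∤w = subst (_≡1-mod q)
    (trans (^-*-assoc w (q ∸ 1) t) (cong (w ^_) (trans (*-comm (q ∸ 1) t) (sym (m∣n⇒n≡quotient*m q-1∣2n)))))
    (≡1-mod-^ {q} t (fermat-∤ pq w q∤w))
  q∣2 : q ∣ 2
  q∣2 = ≡1-mod-+⇒∣2 (one x (prime∣z⇒∤x {2 * n} x⊥y sol pq q∣z))
                     (one y (prime∣z⇒∤x {2 * n} (NoCommonPrime-sym x⊥y) (trans (+-comm (y ^ (2 * n)) (x ^ (2 * n))) sol) pq q∣z))
                     (subst (q ∣_) (sym sol) (∣⇒∣^ z (2 * n) q∣z))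

-- Fermat's descent for x⁴ + y⁴ = z²

prime²∣-of-square : ∀ {u v w q} → NoCommonPrime u v → u * v ≡ w * w → Prime q → q ∣ u →
                    ∃[ u′ ] ∃[ w′ ] u ≡ u′ * (q * q) × u′ * v ≡ w′ * w′
prime²∣-of-square {u} {v} {w} {q} u⊥v uv≡ww pq q∣u = u″ , w′ , u≡ , u″v≡
  where
  instance _ = prime⇒nonZero pq
  swap : ∀ a b c → a * b * c ≡ a * c * b
  swap = solve-∀
  regroup : ∀ a q → a * a * q * q ≡ a * q * (a * q)
  regroup = solve-∀
  u′ = quotient q∣u
  q∣w : q ∣ w
  q∣w = prime∣m*m⇒prime∣m w pq (subst (q ∣_) uv≡ww (∣m⇒∣m*n v q∣u))
  w′ = quotient q∣w
  u′v≡ : u′ * v ≡ w′ * w′ * q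
  u′v≡ = *-cancelʳ-≡ _ _ q (begin
    u′ * v * q         ≡⟨ swap u′ v q ⟩
    u′ * q * v         ≡⟨ cong (_* v) (m∣n⇒n≡quotient*m q∣u) ⟨
    u * v              ≡⟨ uv≡ww ⟩
    w * w              ≡⟨ cong (λ t → t * t) (m∣n⇒n≡quotient*m q∣w) ⟩
    w′ * q * (w′ * q)  ≡⟨ regroup w′ q ⟨
    w′ * w′ * q * q    ∎)
    where open ≡-Reasoning
  q∣u′ : q ∣ u′
  q∣u′ = [ id , (λ q∣v → ⊥-elim (u⊥v q pq q∣u q∣v)) ]′ (euclidsLemma u′ v pq (divides (w′ * w′) u′v≡))
  u″ = quotient q∣u′
  u≡ : u ≡ u″ * (q * q)
  u≡ = trans (m∣n⇒n≡quotient*m q∣u) (trans (cong (_* q) (m∣n⇒n≡quotient*m q∣u′)) (*-assoc u″ q q))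
  u″v≡ : u″ * v ≡ w′ * w′
  u″v≡ = *-cancelʳ-≡ _ _ q (trans (swap u″ v q) (trans (cong (_* v) (sym (m∣n⇒n≡quotient*m q∣u′))) u′v≡))

square-factor : ∀ u {v} w → NoCommonPrime u v → u * v ≡ w * w → ∃[ a ] u ≡ a * a
square-factor = <-rec _ step
  where
  step : ∀ u → (∀ {u′} → u′ < u → ∀ {v} w → NoCommonPrime u′ v → u′ * v ≡ w * w → ∃[ a ] u′ ≡ a * a) →
         ∀ {v} w → NoCommonPrime u v → u * v ≡ w * w → ∃[ a ] u ≡ a * a
  step 0        _   _ _ _ = 0 , refl
  step 1        _   _ _ _ = 1 , refl
  step u@(2+ _) rec {v} w u⊥v uv≡ww = descend (∃-prime-factor {u} (s<s z<s))
    where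
    descend : ∃[ q ] Prime q × q ∣ u → ∃[ a ] u ≡ a * a
    descend (q , pq , q∣u) = a * q , trans u≡ (trans (cong (_* (q * q)) u′≡aa) (regroup a q))
      where
      regroup : ∀ a q → a * a * (q * q) ≡ a * q * (a * q)
      regroup = solve-∀
      peeled = prime²∣-of-square {w = w} u⊥v uv≡ww pq q∣u
      u′ = proj₁ peeled
      w′ = proj₁ (proj₂ peeled)
      u≡ : u ≡ u′ * (q * q)
      u≡ = proj₁ (proj₂ (proj₂ peeled))
      u′<u : u′ < u
      u′<u = subst (u′ <_) (sym u≡) (m<m*n u′ (q * q) {{m*n≢0⇒m≢0 u′ {{subst NonZero u≡ _}}}}
                                           (≤-trans (prime⇒>1 pq) (m≤m*n q q {{prime⇒nonZero pq}})))
      u′-square : ∃[ a ] u′ ≡ a * a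
      u′-square = rec u′<u w′ (NoCommonPrime-∣ˡ (divides (q * q) (trans u≡ (*-comm u′ _))) u⊥v) (proj₂ (proj₂ (proj₂ peeled)))
      a = proj₁ u′-square
      u′≡aa = proj₂ u′-square

coprime-product-square : ∀ {u v} w → NoCommonPrime u v → u * v ≡ w * w → (∃[ a ] u ≡ a * a) × (∃[ b ] v ≡ b * b)
coprime-product-square {u} {v} w u⊥v uv≡ww =
  square-factor u w u⊥v uv≡ww , square-factor v w (NoCommonPrime-sym u⊥v) (trans (*-comm v u) uv≡ww)

NoCommonPrime-leg : ∀ {a b c} → a * a + b * b ≡ c * c → NoCommonPrime c b → NoCommonPrime a b
NoCommonPrime-leg {a} {b} {c} sum≡ c⊥b q pq q∣a q∣b =
  c⊥b q pq (prime∣m*m⇒prime∣m c pq (subst (q ∣_) sum≡ (∣m∣n⇒∣m+n (∣m⇒∣m*n a q∣a) (∣m⇒∣m*n b q∣b)))) q∣b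

NoCommonPrime-hypotenuse : ∀ {a b c} → c ≡ a * a + b * b → NoCommonPrime a b → NoCommonPrime c (a * b)
NoCommonPrime-hypotenuse {a} {b} c≡ a⊥b q pq q∣c q∣ab with euclidsLemma a b pq q∣ab
... | inj₁ q∣a = a⊥b q pq q∣a (prime∣m*m⇒prime∣m b pq (∣m+n∣m⇒∣n (subst (q ∣_) c≡ q∣c) (∣m⇒∣m*n a q∣a)))
... | inj₂ q∣b = a⊥b q pq (prime∣m*m⇒prime∣m a pq
                   (∣m+n∣m⇒∣n (subst (q ∣_) (trans c≡ (+-comm (a * a) (b * b))) q∣c) (∣m⇒∣m*n b q∣b))) q∣b

odd²+odd²≢square : ∀ {x k m} → ¬ 2 ∣ x → ¬ 2 ∣ k → x * x + k * k ≢ m * m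
odd²+odd²≢square {x} {k} {m} 2∤x 2∤k sum≡mm = >⇒∤ (s<s (s<s z<s)) (≡1-mod-+⇒∣2 x²≡ k²≡ 4∣sum)
  where
  x²≡ = odd*odd≡1-mod-4 x 2∤x
  k²≡ = odd*odd≡1-mod-4 k 2∤k
  h = 1 + 2 * (proj₁ x²≡ + proj₁ k²≡)
  sum≡ : x * x + k * k ≡ 2 * h
  sum≡ = trans (cong₂ _+_ (proj₂ x²≡) (proj₂ k²≡)) (regroup (proj₁ x²≡) (proj₁ k²≡))
    where
    regroup : ∀ w w′ → 1 + 4 * w + (1 + 4 * w′) ≡ 2 * (1 + 2 * (w + w′))
    regroup = solve-∀
  2∣m : 2 ∣ m
  2∣m = prime∣m*m⇒prime∣m m prime[2] (subst (2 ∣_) (trans (sym sum≡) sum≡mm) (m∣m*n h))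
  4∣sum : 4 ∣ x * x + k * k
  4∣sum = subst (4 ∣_) (sym sum≡mm) (*-pres-∣ 2∣m 2∣m)

hypotenuse≡odd-leg+even : ∀ {A B} C → NoCommonPrime A B → 2 ∣ B → A * A + B * B ≡ C * C → ∃[ v ] C ≡ A + 2 * v
hypotenuse≡odd-leg+even {A} {B} C A⊥B 2∣B sol = c ∸ a , (begin
  C                      ≡⟨ C≡ ⟩
  1 + 2 * c              ≡⟨ cong (λ t → 1 + 2 * t) (m+[n∸m]≡n a≤c) ⟨
  1 + 2 * (a + (c ∸ a))  ≡⟨ cong suc (*-distribˡ-+ 2 a (c ∸ a)) ⟩
  1 + 2 * a + 2 * (c ∸ a) ≡⟨ cong (_+ 2 * (c ∸ a)) A≡ ⟨
  A + 2 * (c ∸ a)        ∎)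
  where
  open ≡-Reasoning
  2∤A : ¬ 2 ∣ A
  2∤A 2∣A = A⊥B 2 prime[2] 2∣A 2∣B
  2∤C : ¬ 2 ∣ C
  2∤C 2∣C = 2∤A (prime∣m*m⇒prime∣m A prime[2]
    (∣m+n∣m⇒∣n (subst (2 ∣_) (trans (sym sol) (+-comm (A * A) (B * B))) (∣m⇒∣m*n C 2∣C)) (∣m⇒∣m*n B 2∣B)))
  a = proj₁ (¬2∣⇒odd A 2∤A)
  A≡ = proj₂ (¬2∣⇒odd A 2∤A)
  c = proj₁ (¬2∣⇒odd C 2∤C)
  C≡ = proj₂ (¬2∣⇒odd C 2∤C)
  a≤c : a ≤ c
  a≤c = *-cancelˡ-≤ 2 (s≤s⁻¹ (subst₂ _≤_ A≡ C≡ (*-self-≤⇒≤ (subst (A * A ≤_) sol (m≤m+n (A * A) (B * B))))))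

half-legs-identity : ∀ {A B C v β} → C ≡ A + 2 * v → B ≡ 2 * β → A * A + B * B ≡ C * C → β * β ≡ v * (A + v)
half-legs-identity {A} {B} {C} {v} {β} C≡ B≡ sol = *-cancelˡ-≡ _ _ 4 (+-cancelˡ-≡ (A * A) _ _ (begin
  A * A + 4 * (β * β)        ≡⟨ expand₁ A β ⟩
  A * A + 2 * β * (2 * β)    ≡⟨ cong (λ t → A * A + t * t) B≡ ⟨
  A * A + B * B              ≡⟨ sol ⟩
  C * C                      ≡⟨ cong (λ t → t * t) C≡ ⟩
  (A + 2 * v) * (A + 2 * v)  ≡⟨ expand₂ A v ⟩
  A * A + 4 * (v * (A + v))  ∎))
  where
  open ≡-Reasoning
  expand₁ : ∀ A β → A * A + 4 * (β * β) ≡ A * A + 2 * β * (2 * β)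
  expand₁ = solve-∀
  expand₂ : ∀ A v → (A + 2 * v) * (A + 2 * v) ≡ A * A + 4 * (v * (A + v))
  expand₂ = solve-∀

-- The odd leg A enters as A + k² = m², avoiding truncated subtraction.
record PythagoreanParameters (A B C : ℕ) : Set where
  field
    m k        : ℕ
    coprime    : NoCommonPrime m k
    odd-leg    : A + k * k ≡ m * m
    even-leg   : B ≡ 2 * m * k
    hypotenuse : C ≡ m * m + k * k

pythagorean : ∀ {A B} C → NoCommonPrime A B → 2 ∣ B → A * A + B * B ≡ C * C → PythagoreanParameters A B C
pythagorean {A} {B} C A⊥B 2∣B sol = record
  { m = m ; k = k ; coprime = NoCommonPrime-*-self⁻ (subst₂ NoCommonPrime A+v≡mm v≡kk (NoCommonPrime-sym v⊥A+v))
  ; odd-leg    = trans (cong (A +_) (sym v≡kk)) A+v≡mm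
  ; even-leg   = *-self-injective B*B≡
  ; hypotenuse = trans C≡ (trans (sym (+-assoc A v (v + 0))) (cong₂ _+_ A+v≡mm (trans (+-identityʳ v) v≡kk)))
  }
  where
  open ≡-Reasoning
  v = proj₁ (hypotenuse≡odd-leg+even C A⊥B 2∣B sol)
  C≡ = proj₂ (hypotenuse≡odd-leg+even C A⊥B 2∣B sol)
  β = quotient 2∣B
  B≡ : B ≡ 2 * β
  B≡ = m∣n⇒n≡m*quotient 2∣B
  ββ≡ : β * β ≡ v * (A + v)
  ββ≡ = half-legs-identity {A} {v = v} {β} C≡ B≡ sol
  v⊥A+v : NoCommonPrime v (A + v)
  v⊥A+v q pq q∣v q∣A+v = A⊥B q pq (∣m+n∣m⇒∣n (subst (q ∣_) (+-comm A v) q∣A+v) q∣v)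
    (∣-trans (prime∣m*m⇒prime∣m β pq (subst (q ∣_) (sym ββ≡) (∣m⇒∣m*n (A + v) q∣v))) (divides 2 B≡))
  squares = coprime-product-square β v⊥A+v (sym ββ≡)
  k = proj₁ (proj₁ squares)
  v≡kk = proj₂ (proj₁ squares)
  m = proj₁ (proj₂ squares)
  A+v≡mm = proj₂ (proj₂ squares)
  B*B≡ : B * B ≡ 2 * m * k * (2 * m * k)
  B*B≡ = begin
    B * B                    ≡⟨ cong (λ t → t * t) B≡ ⟩
    2 * β * (2 * β)          ≡⟨ regroup₁ β ⟩
    4 * (β * β)              ≡⟨ cong (4 *_) (trans ββ≡ (cong₂ _*_ v≡kk A+v≡mm)) ⟩
    4 * (k * k * (m * m))    ≡⟨ regroup₂ m k ⟩
    2 * m * k * (2 * m * k)  ∎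
    where
    regroup₁ : ∀ β → 2 * β * (2 * β) ≡ 4 * (β * β)
    regroup₁ = solve-∀
    regroup₂ : ∀ m k → 4 * (k * k * (m * m)) ≡ 2 * m * k * (2 * m * k)
    regroup₂ = solve-∀

record PrimitiveQuartic (z : ℕ) : Set where
  field
    x y      : ℕ
    x>0      : 0 < x
    y>0      : 0 < y
    coprime  : NoCommonPrime x y
    equation : x * x * (x * x) + y * y * (y * y) ≡ z * z

PrimitiveQuartic-sym : ∀ {z} → PrimitiveQuartic z → PrimitiveQuartic z
PrimitiveQuartic-sym sol = record
  { x = y ; y = x ; x>0 = y>0 ; y>0 = x>0 ; coprime = NoCommonPrime-sym coprime
  ; equation = trans (+-comm (y * y * (y * y)) (x * x * (x * x))) equation }
  where open PrimitiveQuartic sol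

-- m and r s are coprime, so m, r and s are squares c², a², b².
hypotenuse*legs-square⇒quartic : ∀ {m r s h} → NoCommonPrime r s → m ≡ r * r + s * s → m * (r * s) ≡ h * h →
                                0 < r * s → ∃[ c ] m ≡ c * c × PrimitiveQuartic c
hypotenuse*legs-square⇒quartic {m} {r} {s} {h} r⊥s m≡ m*rs≡hh rs>0 = c , m≡cc , record
  { x = a ; y = b
  ; x>0 = *-positiveˡ a (subst (0 <_) r≡aa (*-positiveˡ r rs>0))
  ; y>0 = *-positiveˡ b (subst (0 <_) s≡bb (*-positiveʳ r rs>0))
  ; coprime  = NoCommonPrime-*-self⁻ (subst₂ NoCommonPrime r≡aa s≡bb r⊥s)
  ; equation = trans (cong₂ (λ u v → u * u + v * v) (sym r≡aa) (sym s≡bb)) (trans (sym m≡) m≡cc) }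
  where
  m-and-rs = coprime-product-square h (NoCommonPrime-hypotenuse m≡ r⊥s) m*rs≡hh
  c = proj₁ (proj₁ m-and-rs)
  m≡cc = proj₂ (proj₁ m-and-rs)
  r-and-s = coprime-product-square (proj₁ (proj₂ m-and-rs)) r⊥s (proj₂ (proj₂ m-and-rs))
  a = proj₁ (proj₁ r-and-s)
  r≡aa = proj₂ (proj₁ r-and-s)
  b = proj₁ (proj₂ r-and-s)
  s≡bb = proj₂ (proj₂ r-and-s)

half-even-leg² : ∀ {y m k r s} (2∣y : 2 ∣ y) → y * y ≡ 2 * m * k → k ≡ 2 * r * s →
                 quotient 2∣y * quotient 2∣y ≡ m * (r * s)
half-even-leg² {y} {m} {k} {r} {s} 2∣y yy≡ k≡ = *-cancelˡ-≡ _ _ 4 (begin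
  4 * (h * h)          ≡⟨ regroup₁ h ⟩
  2 * h * (2 * h)      ≡⟨ cong (λ t → t * t) (m∣n⇒n≡m*quotient 2∣y) ⟨
  y * y                ≡⟨ yy≡ ⟩
  2 * m * k            ≡⟨ cong (2 * m *_) k≡ ⟩
  2 * m * (2 * r * s)  ≡⟨ regroup₂ m r s ⟩
  4 * (m * (r * s))    ∎)
  where
  open ≡-Reasoning
  h = quotient 2∣y
  regroup₁ : ∀ h → 4 * (h * h) ≡ 2 * h * (2 * h)
  regroup₁ = solve-∀
  regroup₂ : ∀ m r s → 2 * m * (2 * r * s) ≡ 4 * (m * (r * s))
  regroup₂ = solve-∀

square-root-< : ∀ {c m k z} → 0 < m → 0 < k → m ≡ c * c → m * m + k * k ≡ z → c < z
square-root-< {c} {m} {k} {z} m>0 k>0 m≡cc sum≡z = begin-strict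
  c              ≤⟨ m≤m*n c c {{>-nonZero (*-positiveˡ c (subst (0 <_) m≡cc m>0))}} ⟩
  c * c          ≡⟨ m≡cc ⟨
  m              ≤⟨ m≤m*n m m {{>-nonZero m>0}} ⟩
  m * m          <⟨ m<m+n (m * m) (*-mono-< k>0 k>0) ⟩
  m * m + k * k  ≡⟨ sum≡z ⟩
  z              ∎
  where open ≤-Reasoning

-- x² + k² = m², y² = 2mk, z = m² + k² from the first parametrisation; k = 2rs, m = r² + s² from the
-- second, applied to x² + k² = m². Then (y/2)² = m r s.
quartic-descent-odd-even : ∀ {z} (sol : PrimitiveQuartic z) →
  ¬ 2 ∣ PrimitiveQuartic.x sol → 2 ∣ PrimitiveQuartic.y sol → ∃[ c ] c < z × PrimitiveQuartic c
quartic-descent-odd-even {z} sol 2∤x 2∣y = outer (pythagorean z (NoCommonPrime-*-self coprime) (∣m⇒∣m*n y 2∣y) equation)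
  where
  open PrimitiveQuartic sol
  outer : PythagoreanParameters (x * x) (y * y) z → ∃[ c ] c < z × PrimitiveQuartic c
  outer P = inner (pythagorean m (NoCommonPrime-leg odd-leg m⊥k) 2∣k odd-leg)
    where
    open PythagoreanParameters P using (m; k; odd-leg; even-leg; hypotenuse) renaming (coprime to m⊥k)
    2∣k : 2 ∣ k
    2∣k with 2 ∣? k
    ... | yes 2∣k = 2∣k
    ... | no  2∤k = contradiction odd-leg (odd²+odd²≢square {m = m} 2∤x 2∤k)
    m>0 : 0 < m
    m>0 = *-positiveʳ 2 (*-positiveˡ (2 * m) (subst (0 <_) even-leg (*-mono-< y>0 y>0)))
    k>0 : 0 < k
    k>0 = *-positiveʳ (2 * m) (subst (0 <_) even-leg (*-mono-< y>0 y>0))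
    inner : PythagoreanParameters x k m → ∃[ c ] c < z × PrimitiveQuartic c
    inner Q = c , square-root-< m>0 k>0 m≡cc (sym hypotenuse) , proj₂ (proj₂ descended)
      where
      open PythagoreanParameters Q using () renaming (m to r; k to s; coprime to r⊥s; even-leg to k≡; hypotenuse to m≡)
      rs>0 : 0 < r * s
      rs>0 = *-positiveʳ 2 (subst (0 <_) (trans k≡ (*-assoc 2 r s)) k>0)
      descended = hypotenuse*legs-square⇒quartic {h = quotient 2∣y} r⊥s m≡ (sym (half-even-leg² {m = m} {r = r} {s = s} 2∣y even-leg k≡)) rs>0
      c = proj₁ descended
      m≡cc = proj₁ (proj₂ descended)

quartic-descent : ∀ {z} → PrimitiveQuartic z → ∃[ c ] c < z × PrimitiveQuartic c
quartic-descent {z} sol with 2 ∣? PrimitiveQuartic.x sol | 2 ∣? PrimitiveQuartic.y sol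
... | no 2∤x  | yes 2∣y = quartic-descent-odd-even sol 2∤x 2∣y
... | yes 2∣x | no 2∤y  = quartic-descent-odd-even (PrimitiveQuartic-sym sol) 2∤y 2∣x
... | yes 2∣x | yes 2∣y = ⊥-elim (PrimitiveQuartic.coprime sol 2 prime[2] 2∣x 2∣y)
... | no 2∤x  | no 2∤y  = contradiction (PrimitiveQuartic.equation sol) (odd²+odd²≢square {m = z} (odd² 2∤x) (odd² 2∤y))
  where
  odd² : ∀ {w} → ¬ 2 ∣ w → ¬ 2 ∣ w * w
  odd² {w} 2∤w 2∣ww = 2∤w (prime∣m*m⇒prime∣m w prime[2] 2∣ww)

no-primitive-quartic : ∀ z → ¬ PrimitiveQuartic z
no-primitive-quartic = <-rec _ λ z rec sol → let (c , c<z , sol′) = quartic-descent sol in rec c<z sol′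

-- Sums of odd powers

record PowerSumFactorisation (X Y r : ℕ) : Set where
  field
    cofactor       : ℕ
    factorisation  : (X + Y) * cofactor ≡ X ^ r + Y ^ r
    common-divisor : ∀ {d} → d ∣ X + Y → d ∣ cofactor → d ∣ r * X ^ r

module _ where

  open import Data.Integer.Base using (ℤ; +_; -_)
    renaming (∣_∣ to ∣_∣ᶻ; _+_ to _+ᶻ_; _*_ to _*ᶻ_; _-_ to _-ᶻ_; _^_ to _^ᶻ_)
  import Data.Integer.Divisibility.Signed as ℤᵈ
  import Data.Integer.Properties as ℤ
  import Data.Integer.Tactic.RingSolver as ℤ-Solver

  geometricSum : ℤ → ℤ → ℕ → ℤ
  geometricSum a b zero    = + 0
  geometricSum a b (suc r) = a ^ᶻ r +ᶻ b *ᶻ geometricSum a b r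

  geometricSum-telescopes : ∀ a b r → (a -ᶻ b) *ᶻ geometricSum a b r ≡ a ^ᶻ r -ᶻ b ^ᶻ r
  geometricSum-telescopes a b zero    = ℤ.*-zeroʳ (a -ᶻ b)
  geometricSum-telescopes a b (suc r) = begin
    (a -ᶻ b) *ᶻ (a ^ᶻ r +ᶻ b *ᶻ G)                 ≡⟨ distribute a b (a ^ᶻ r) G ⟩
    (a -ᶻ b) *ᶻ a ^ᶻ r +ᶻ b *ᶻ ((a -ᶻ b) *ᶻ G)     ≡⟨ cong (λ t → (a -ᶻ b) *ᶻ a ^ᶻ r +ᶻ b *ᶻ t) (geometricSum-telescopes a b r) ⟩
    (a -ᶻ b) *ᶻ a ^ᶻ r +ᶻ b *ᶻ (a ^ᶻ r -ᶻ b ^ᶻ r)  ≡⟨ cancel a b (a ^ᶻ r) (b ^ᶻ r) ⟩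
    a *ᶻ a ^ᶻ r -ᶻ b *ᶻ b ^ᶻ r                     ∎
    where
    open ≡-Reasoning
    G = geometricSum a b r
    distribute : ∀ a b A g → (a -ᶻ b) *ᶻ (A +ᶻ b *ᶻ g) ≡ (a -ᶻ b) *ᶻ A +ᶻ b *ᶻ ((a -ᶻ b) *ᶻ g)
    distribute = ℤ-Solver.solve-∀
    cancel : ∀ a b A B → (a -ᶻ b) *ᶻ A +ᶻ b *ᶻ (A -ᶻ B) ≡ a *ᶻ A -ᶻ b *ᶻ B
    cancel = ℤ-Solver.solve-∀

  -- Modulo a - b, b ≡ a and the geometric sum is congruent to r a^(r-1).
  geometricSum-congruence : ∀ a b r → (a -ᶻ b) ℤᵈ.∣ a *ᶻ geometricSum a b r -ᶻ + r *ᶻ a ^ᶻ r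
  geometricSum-congruence a b zero    = ℤᵈ.divides (+ 0) (vanish a b)
    where
    vanish : ∀ a b → a *ᶻ + 0 -ᶻ + 0 *ᶻ + 1 ≡ + 0 *ᶻ (a -ᶻ b)
    vanish = ℤ-Solver.solve-∀
  geometricSum-congruence a b (suc r) = subst ((a -ᶻ b) ℤᵈ.∣_) (sym step)
    (ℤᵈ.∣m∣n⇒∣m+n (ℤᵈ.∣n⇒∣m*n b (geometricSum-congruence a b r))
                  (ℤᵈ.divides (- (+ r *ᶻ a ^ᶻ r)) (flip (+ r) (a ^ᶻ r) a b)))
    where
    G = geometricSum a b r
    regroup : ∀ a b A g R → a *ᶻ (A +ᶻ b *ᶻ g) -ᶻ (+ 1 +ᶻ R) *ᶻ (a *ᶻ A) ≡ b *ᶻ (a *ᶻ g -ᶻ R *ᶻ A) +ᶻ R *ᶻ A *ᶻ (b -ᶻ a)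
    regroup = ℤ-Solver.solve-∀
    flip : ∀ R A a b → R *ᶻ A *ᶻ (b -ᶻ a) ≡ - (R *ᶻ A) *ᶻ (a -ᶻ b)
    flip = ℤ-Solver.solve-∀
    step : a *ᶻ geometricSum a b (suc r) -ᶻ + suc r *ᶻ a ^ᶻ suc r ≡ b *ᶻ (a *ᶻ G -ᶻ + r *ᶻ a ^ᶻ r) +ᶻ + r *ᶻ a ^ᶻ r *ᶻ (b -ᶻ a)
    step = trans (cong (λ s → a *ᶻ geometricSum a b (suc r) -ᶻ s *ᶻ (a *ᶻ a ^ᶻ r)) (ℤ.pos-+ 1 r))
                 (regroup a b (a ^ᶻ r) G (+ r))

  +-^ : ∀ X r → (+ X) ^ᶻ r ≡ + (X ^ r)
  +-^ X zero    = refl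
  +-^ X (suc r) = trans (cong (+ X *ᶻ_) (+-^ X r)) (sym (ℤ.pos-* X (X ^ r)))

  -‿^-odd : ∀ y h → (- y) ^ᶻ suc (2 * h) ≡ - (y ^ᶻ suc (2 * h))
  -‿^-odd y zero    = sym (ℤ.neg-distribˡ-* y (+ 1))
  -‿^-odd y (suc h) = begin
    (- y) ^ᶻ suc (2 * suc h)                  ≡⟨ cong (λ k → (- y) ^ᶻ suc k) (*-suc 2 h) ⟩
    (- y) *ᶻ ((- y) *ᶻ (- y) ^ᶻ suc (2 * h))  ≡⟨ cong (λ t → (- y) *ᶻ ((- y) *ᶻ t)) (-‿^-odd y h) ⟩
    (- y) *ᶻ ((- y) *ᶻ - Y)                   ≡⟨ signs y Y ⟩
    - (y *ᶻ (y *ᶻ Y))                         ≡⟨ cong (λ k → - (y ^ᶻ suc k)) (*-suc 2 h) ⟨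
    - (y ^ᶻ suc (2 * suc h))                  ∎
    where
    open ≡-Reasoning
    Y = y ^ᶻ suc (2 * h)
    signs : ∀ y Y → (- y) *ᶻ ((- y) *ᶻ - Y) ≡ - (y *ᶻ (y *ᶻ Y))
    signs = ℤ-Solver.solve-∀

  odd-power-sum : ∀ X Y h → PowerSumFactorisation X Y (suc (2 * h))
  odd-power-sum X Y h = record { cofactor = ∣ G ∣ᶻ ; factorisation = factorisation ; common-divisor = common-divisor }
    where
    open ≡-Reasoning
    r = suc (2 * h)
    G = geometricSum (+ X) (- + Y) r
    X+Y≡ : + X -ᶻ - + Y ≡ + (X + Y)
    X+Y≡ = trans (cong (_+ᶻ_ (+ X)) (ℤ.neg-involutive (+ Y))) (sym (ℤ.pos-+ X Y))
    factorisation : (X + Y) * ∣ G ∣ᶻ ≡ X ^ r + Y ^ r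
    factorisation = trans (sym (ℤ.abs-* (+ (X + Y)) G)) (cong ∣_∣ᶻ (begin
      + (X + Y) *ᶻ G                    ≡⟨ cong (_*ᶻ G) X+Y≡ ⟨
      (+ X -ᶻ - + Y) *ᶻ G               ≡⟨ geometricSum-telescopes (+ X) (- + Y) r ⟩
      (+ X) ^ᶻ r -ᶻ (- + Y) ^ᶻ r        ≡⟨ cong₂ _-ᶻ_ (+-^ X r) (trans (-‿^-odd (+ Y) h) (cong -_ (+-^ Y r))) ⟩
      + (X ^ r) -ᶻ - + (Y ^ r)          ≡⟨ cong (_+ᶻ_ (+ (X ^ r))) (ℤ.neg-involutive (+ (Y ^ r))) ⟩
      + (X ^ r) +ᶻ + (Y ^ r)            ≡⟨ ℤ.pos-+ (X ^ r) (Y ^ r) ⟨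
      + (X ^ r + Y ^ r)                 ∎))
    common-divisor : ∀ {d} → d ∣ X + Y → d ∣ ∣ G ∣ᶻ → d ∣ r * X ^ r
    common-divisor {d} d∣X+Y d∣G = ℤᵈ.∣⇒∣ᵤ (subst (+ d ℤᵈ.∣_) rXʳ≡ (subst (+ d ℤᵈ.∣_) (difference (+ X *ᶻ G) _)
                                     (ℤᵈ.∣m∣n⇒∣m-n d∣XG d∣XG-rXʳ)))
      where
      difference : ∀ u v → u -ᶻ (u -ᶻ v) ≡ v
      difference = ℤ-Solver.solve-∀
      d∣XG : + d ℤᵈ.∣ + X *ᶻ G
      d∣XG = ℤᵈ.∣n⇒∣m*n (+ X) (ℤᵈ.∣ᵤ⇒∣ d∣G)
      d∣XG-rXʳ : + d ℤᵈ.∣ + X *ᶻ G -ᶻ + r *ᶻ (+ X) ^ᶻ r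
      d∣XG-rXʳ = ℤᵈ.∣-trans (subst (+ d ℤᵈ.∣_) (sym X+Y≡) (ℤᵈ.∣ᵤ⇒∣ d∣X+Y)) (geometricSum-congruence (+ X) (- + Y) r)
      rXʳ≡ : + r *ᶻ (+ X) ^ᶻ r ≡ + (r * X ^ r)
      rXʳ≡ = trans (cong (+ r *ᶻ_) (+-^ X r)) (sym (ℤ.pos-* r (X ^ r)))


-- Odd prime exponents with a prime-power right-hand side

cross-expand : ∀ X Y A B → (X + Y) * (A + B) ≡ X * A + Y * B + (X * B + Y * A)
cross-expand = solve-∀

^-+-superadditive : ∀ X Y k → X ^ suc k + Y ^ suc k ≤ (X + Y) ^ suc k
^-+-superadditive X Y zero    = ≤-reflexive (sym (*-distribʳ-+ 1 X Y))
^-+-superadditive X Y (suc k) = begin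
  X * X ^ suc k + Y * Y ^ suc k                                     ≤⟨ m≤m+n _ _ ⟩
  X * X ^ suc k + Y * Y ^ suc k + (X * Y ^ suc k + Y * X ^ suc k)   ≡⟨ cross-expand X Y _ _ ⟨
  (X + Y) * (X ^ suc k + Y ^ suc k)                                 ≤⟨ *-monoʳ-≤ (X + Y) (^-+-superadditive X Y k) ⟩
  (X + Y) * (X + Y) ^ suc k                                         ∎
  where open ≤-Reasoning

^-+-strictly-superadditive : ∀ {X Y} k → 0 < X → 0 < Y → X ^ (2 + k) + Y ^ (2 + k) < (X + Y) ^ (2 + k)
^-+-strictly-superadditive {X} {Y} k X>0 Y>0 = begin-strict
  X * X ^ suc k + Y * Y ^ suc k                                     <⟨ m<m+n _ (<-≤-trans XYᵏ>0 (m≤m+n _ _)) ⟩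
  X * X ^ suc k + Y * Y ^ suc k + (X * Y ^ suc k + Y * X ^ suc k)   ≡⟨ cross-expand X Y _ _ ⟨
  (X + Y) * (X ^ suc k + Y ^ suc k)                                 ≤⟨ *-monoʳ-≤ (X + Y) (^-+-superadditive X Y k) ⟩
  (X + Y) * (X + Y) ^ suc k                                         ∎
  where
  open ≤-Reasoning
  XYᵏ>0 : 0 < X * Y ^ suc k
  XYᵏ>0 = *-mono-< X>0 (m^n>0 Y {{>-nonZero Y>0}} (suc k))

^-+-≡⇒< : ∀ {X Y Z} r → .{{NonZero r}} → 0 < Y → X ^ r + Y ^ r ≡ Z ^ r → X < Z
^-+-≡⇒< {X} {Y} {Z} r Y>0 sum≡ with Z ≤? X
... | no  Z≰X = ≰⇒> Z≰X
... | yes Z≤X = contradiction (^-monoˡ-≤ r Z≤X)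
                  (<⇒≱ (subst (X ^ r <_) sum≡ (m<m+n (X ^ r) (m^n>0 Y {{>-nonZero Y>0}} r))))

module _ {p X Y Z T : ℕ} (h : ℕ) (pp : Prime p) (pr : Prime (suc (2 * suc h))) (X>0 : 0 < X) (Y>0 : 0 < Y)
         (p∤X : ¬ p ∣ X) (Z≡pᵀ : Z ≡ p ^ T) (T≥1 : 1 ≤ T) where

  private
    r = suc (2 * suc h)
    p≢0 = prime⇒nonZero pp
    p≤Z : p ≤ Z
    p≤Z = subst₂ _≤_ (*-identityʳ p) (sym Z≡pᵀ) (^-monoʳ-≤ p {{p≢0}} T≥1)
    Z≢0 = >-nonZero (<-≤-trans (prime⇒>0 pp) p≤Z)
    Zʳ≡ : Z ^ r ≡ p ^ (T * r)
    Zʳ≡ = trans (cong (_^ r) Z≡pᵀ) (^-*-assoc p T r)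

    module _ (F : PowerSumFactorisation X Y r) (sum≡ : X ^ r + Y ^ r ≡ Z ^ r) where
      open PowerSumFactorisation F renaming (cofactor to Q)

      S = X + Y
      SQ≡ : S * Q ≡ Z ^ r
      SQ≡ = trans factorisation sum≡
      S≢0 = >-nonZero (<-≤-trans X>0 (m≤m+n X Y))
      Q≢0 = >-nonZero (*-positiveʳ S (subst (0 <_) (sym SQ≡) (m^n>0 Z {{Z≢0}} r)))

      Z<S : Z < S
      Z<S = ≰⇒> λ S≤Z → <⇒≱ (^-+-strictly-superadditive (h + 1 * suc h) X>0 Y>0)
                               (subst (S ^ r ≤_) (sym sum≡) (^-monoˡ-≤ r S≤Z))

      p²∣S : p * p ∣ S
      p²∣S = [ (λ S≤p → contradiction (≤-trans S≤p p≤Z) (<⇒≱ Z<S)) , id ]′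
               (∣prime^⇒≤∨square∣ (T * r) {{S≢0}} pp (subst (S ∣_) Zʳ≡ (divides Q (trans (sym SQ≡) (*-comm S Q)))))

      p²∤Q : ¬ p * p ∣ Q
      p²∤Q p²∣Q = p∤Xʳ (p∣Xʳ (euclidsLemma r (X ^ r) pp (∣-trans (m∣m*n p) p²∣rXʳ)))
        where
        p²∣rXʳ : p * p ∣ r * X ^ r
        p²∣rXʳ = common-divisor p²∣S p²∣Q
        p∤Xʳ : ¬ p ∣ X ^ r
        p∤Xʳ p∣Xʳ = p∤X (prime∣^⇒prime∣ X r pp p∣Xʳ)
        p∣Xʳ : p ∣ r ⊎ p ∣ X ^ r → p ∣ X ^ r
        p∣Xʳ (inj₁ p∣r)  = *-cancelˡ-∣ p {{p≢0}} (subst (λ t → p * p ∣ t * X ^ r) (sym (prime∣prime⇒≡ pp pr p∣r)) p²∣rXʳ)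
        p∣Xʳ (inj₂ p∣Xʳ) = p∣Xʳ

      Q≤p : Q ≤ p
      Q≤p = [ id , (λ p²∣Q → contradiction p²∣Q p²∤Q) ]′
              (∣prime^⇒≤∨square∣ (T * r) {{Q≢0}} pp (subst (Q ∣_) Zʳ≡ (divides S (sym SQ≡))))

      Zʳ<2Zp : Z ^ r < (Z + Z) * p
      Zʳ<2Zp = begin-strict
        Z ^ r        ≡⟨ SQ≡ ⟨
        S * Q        <⟨ *-monoˡ-< Q {{Q≢0}} (+-mono-< (^-+-≡⇒< {X} {Y} {Z} r Y>0 sum≡) (^-+-≡⇒< {Y} {X} {Z} r X>0 (trans (+-comm (Y ^ r) (X ^ r)) sum≡))) ⟩
        (Z + Z) * Q  ≤⟨ *-monoʳ-≤ (Z + Z) Q≤p ⟩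
        (Z + Z) * p  ∎
        where open ≤-Reasoning

    2Zp≤Zʳ : (Z + Z) * p ≤ Z ^ r
    2Zp≤Zʳ = begin
      (Z + Z) * p   ≤⟨ *-monoʳ-≤ (Z + Z) p≤Z ⟩
      (Z + Z) * Z   ≡⟨ cong (_* Z) (double Z) ⟩
      Z * 2 * Z     ≤⟨ *-monoˡ-≤ Z (*-monoʳ-≤ Z (≤-trans (prime⇒>1 pp) p≤Z)) ⟩
      Z * Z * Z     ≡⟨ cube Z ⟩
      Z ^ 3         ≤⟨ ^-monoʳ-≤ Z {{Z≢0}} 3≤r ⟩
      Z ^ r         ∎
      where
      open ≤-Reasoning
      double : ∀ Z → Z + Z ≡ Z * 2
      double = solve-∀
      cube : ∀ Z → Z * Z * Z ≡ Z * (Z * (Z * 1))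
      cube = solve-∀
      3≤r : 3 ≤ r
      3≤r = s≤s (s≤s (≤-trans (s≤s z≤n) (m≤n+m (1 * suc h) h)))

  odd-prime-power-exponent : X ^ r + Y ^ r ≢ Z ^ r
  odd-prime-power-exponent sum≡ = <⇒≱ (Zʳ<2Zp (odd-power-sum X Y (suc h)) sum≡) 2Zp≤Zʳ

record PositiveSolution (e z : ℕ) : Set where
  field
    x y      : ℕ
    x>0      : 0 < x
    y>0      : 0 < y
    equation : x ^ e + y ^ e ≡ z ^ e

solution⇒z>1 : ∀ e {x y z} .{{_ : NonZero e}} → 0 < x → 0 < y → x ^ e + y ^ e ≡ z ^ e → 1 < z
solution⇒z>1 e {x} {y} {0} x>0 y>0 sol = contradiction (trans sol (0^ e)) (>⇒≢ (<-≤-trans (m^n>0 x {{>-nonZero x>0}} e) (m≤m+n _ _)))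
  where
  0^ : ∀ e .{{_ : NonZero e}} → 0 ^ e ≡ 0
  0^ (suc e) = refl
solution⇒z>1 e {x} {y} {1} x>0 y>0 sol = contradiction (trans sol (^-zeroˡ e))
  (>⇒≢ (+-mono-≤ (m^n>0 x {{>-nonZero x>0}} e) (m^n>0 y {{>-nonZero y>0}} e)))
solution⇒z>1 _ {z = 2+ _} _ _ _ = s<s z<s

descent-common-prime : ∀ {e z q} .{{_ : NonZero e}} (sol : PositiveSolution e z) → Prime q →
  q ∣ PositiveSolution.x sol → q ∣ PositiveSolution.y sol → ∃[ z′ ] z′ ∣ z × z′ < z × PositiveSolution e z′
descent-common-prime {e} {z} {q} sol pq q∣x q∣y = z′ , divides q (trans z≡ (*-comm z′ q)) , z′<z , record
  { x = x′ ; y = y′ ; x>0 = positive x>0 q∣x ; y>0 = positive y>0 q∣y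
  ; equation = *-cancelʳ-≡ _ _ (q ^ e) {{m^n≢0 q e {{prime⇒nonZero pq}}}} (begin
      (x′ ^ e + y′ ^ e) * q ^ e        ≡⟨ *-distribʳ-+ (q ^ e) (x′ ^ e) (y′ ^ e) ⟩
      x′ ^ e * q ^ e + y′ ^ e * q ^ e  ≡⟨ cong₂ _+_ (^-distribʳ-* x′ q e) (^-distribʳ-* y′ q e) ⟨
      (x′ * q) ^ e + (y′ * q) ^ e      ≡⟨ cong₂ (λ a b → a ^ e + b ^ e) (m∣n⇒n≡quotient*m q∣x) (m∣n⇒n≡quotient*m q∣y) ⟨
      x ^ e + y ^ e                    ≡⟨ equation ⟩
      z ^ e                            ≡⟨ cong (_^ e) z≡ ⟩
      (z′ * q) ^ e                     ≡⟨ ^-distribʳ-* z′ q e ⟩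
      z′ ^ e * q ^ e                   ∎) }
  where
  open ≡-Reasoning
  open PositiveSolution sol
  x′ = quotient q∣x
  y′ = quotient q∣y
  q∣z : q ∣ z
  q∣z = prime∣^⇒prime∣ z e pq (subst (q ∣_) equation (∣m∣n⇒∣m+n (∣⇒∣^ x e q∣x) (∣⇒∣^ y e q∣y)))
  z′ = quotient q∣z
  z≡ : z ≡ z′ * q
  z≡ = m∣n⇒n≡quotient*m q∣z
  positive : ∀ {w} → 0 < w → (q∣w : q ∣ w) → 0 < quotient q∣w
  positive w>0 q∣w = *-positiveˡ _ (subst (0 <_) (m∣n⇒n≡quotient*m q∣w) w>0)
  z′<z : z′ < z
  z′<z = subst (z′ <_) (sym z≡)
    (m<m*n z′ q {{>-nonZero (*-positiveˡ z′ (subst (0 <_) z≡ (<-trans z<s (solution⇒z>1 e x>0 y>0 equation))))}} (prime⇒>1 pq))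

no-coprime-solution-4∣ : ∀ {e x y z} → 4 ∣ e → 0 < x → 0 < y → NoCommonPrime x y → x ^ e + y ^ e ≢ z ^ e
no-coprime-solution-4∣ {e} {x} {y} {z} (divides m refl) x>0 y>0 x⊥y sol = no-primitive-quartic (z ^ (m * 2)) record
  { x = x ^ m ; y = y ^ m
  ; x>0 = m^n>0 x {{>-nonZero x>0}} m ; y>0 = m^n>0 y {{>-nonZero y>0}} m
  ; coprime  = NoCommonPrime-^ m x⊥y
  ; equation = trans (cong₂ _+_ (fourth x) (fourth y)) (trans sol (square z)) }
  where
  fourth : ∀ a → a ^ m * a ^ m * (a ^ m * a ^ m) ≡ a ^ (m * 4)
  fourth a = trans (regroup (a ^ m)) (^-*-assoc a m 4)
    where
    regroup : ∀ A → A * A * (A * A) ≡ A * (A * (A * (A * 1)))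
    regroup = solve-∀
  square : ∀ a → a ^ (m * 4) ≡ a ^ (m * 2) * a ^ (m * 2)
  square a = trans (cong (a ^_) (double m)) (^-distribˡ-+-* a (m * 2) (m * 2))
    where
    double : ∀ m → m * 4 ≡ m * 2 + m * 2
    double = solve-∀

odd-prime-factor : ∀ {n} → 1 < n → ¬ 2 ∣ n → ∃[ h ] Prime (suc (2 * suc h)) × suc (2 * suc h) ∣ n
odd-prime-factor 1<n 2∤n with ∃-prime-factor 1<n
... | r , pr , r∣n with ¬2∣⇒odd r (λ 2∣r → 2∤n (subst (_∣ _) (sym (prime∣prime⇒≡ prime[2] pr 2∣r)) r∣n))
...   | zero  , refl = contradiction (prime⇒>1 pr) (<-irrefl refl)
...   | suc h , refl = h , pr , r∣n

-- The allowed prime factors of z; q - 1 ∣ 2n holds for every φ-divisor q of 2n.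
Admissible : ℕ → ℕ → ℕ → Set
Admissible n p z = ∀ q → Prime q → q ∣ z → q ≡ p ⊎ (q ∸ 1) ∣ 2 * n

Admissible-∣ : ∀ {n p z d} → d ∣ z → Admissible n p z → Admissible n p d
Admissible-∣ d∣z adm q pq q∣d = adm q pq (∣-trans q∣d d∣z)

coprime-solution⇒prime-power : ∀ {n p x y z} .{{_ : NonZero n}} → Admissible n p z → 0 < x → 0 < y →
  NoCommonPrime x y → x ^ (2 * n) + y ^ (2 * n) ≡ z ^ (2 * n) → ∃[ T ] z ≡ p ^ T
coprime-solution⇒prime-power {n} {p} {x} {y} {z} adm x>0 y>0 x⊥y sol =
  onlyPrimeFactor⇒power {{>-nonZero (<-trans z<s (solution⇒z>1 (2 * n) x>0 y>0 sol))}} only-p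
  where
  instance _ = m*n≢0 2 n
  only-p : OnlyPrimeFactor p z
  only-p q pq q∣z = [ id , (λ q-1∣2n → contradiction q∣z (pred∣2n⇒∤z x⊥y sol pq q-1∣2n)) ]′ (adm q pq q∣z)

-- With r an odd prime factor of n = t r, this is (x^(2t))^r + (y^(2t))^r = (z^(2t))^r, z a power of p.
no-coprime-solution-odd : ∀ {n p x y z} → 1 < n → ¬ 2 ∣ n → Prime p → Admissible n p z → 0 < x → 0 < y →
  NoCommonPrime x y → x ^ (2 * n) + y ^ (2 * n) ≢ z ^ (2 * n)
no-coprime-solution-odd {n} {p} {x} {y} {z} 1<n 2∤n pp adm x>0 y>0 x⊥y sol =
  odd-prime-power-exponent h pp pr (positive x>0) (positive y>0) p∤xᴸ zᴸ≡ TL≥1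
    (trans (cong₂ _+_ (sym (split x)) (sym (split y))) (trans sol (split z)))
  where
  instance _ = >-nonZero (<-trans z<s 1<n)
  odd-factor = odd-prime-factor 1<n 2∤n
  h = proj₁ odd-factor
  r = suc (2 * suc h)
  pr = proj₁ (proj₂ odd-factor)
  t = quotient (proj₂ (proj₂ odd-factor))
  n≡ : n ≡ t * r
  n≡ = m∣n⇒n≡quotient*m (proj₂ (proj₂ odd-factor))
  L = 2 * t
  split : ∀ w → w ^ (2 * n) ≡ (w ^ L) ^ r
  split w = trans (cong (λ k → w ^ (2 * k)) n≡) (trans (cong (w ^_) (sym (*-assoc 2 t r))) (sym (^-*-assoc w L r)))
  positive : ∀ {w} → 0 < w → 0 < w ^ L
  positive {w} w>0 = m^n>0 w {{>-nonZero w>0}} L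
  T = proj₁ (coprime-solution⇒prime-power adm x>0 y>0 x⊥y sol)
  z≡ : z ≡ p ^ T
  z≡ = proj₂ (coprime-solution⇒prime-power adm x>0 y>0 x⊥y sol)
  T≥1 : 1 ≤ T
  T≥1 with T | z≡
  ... | 0     | z≡1 = contradiction z≡1 (>⇒≢ (solution⇒z>1 (2 * n) {{m*n≢0 2 n}} x>0 y>0 sol))
  ... | suc _ | _   = s≤s z≤n
  TL≥1 : 1 ≤ T * L
  TL≥1 = *-mono-≤ T≥1 (*-mono-≤ {1} {2} (s≤s z≤n) (*-positiveˡ t (subst (0 <_) n≡ (<-trans z<s 1<n))))
  zᴸ≡ : z ^ L ≡ p ^ (T * L)
  zᴸ≡ = trans (cong (_^ L) z≡) (^-*-assoc p T L)
  p∤xᴸ : ¬ p ∣ x ^ L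
  p∤xᴸ p∣xᴸ = prime∣z⇒∤x {2 * n} {{m*n≢0 2 n}} x⊥y sol pp (subst (p ∣_) (sym z≡) (∣⇒∣^ p T {{>-nonZero T≥1}} ∣-refl))
                (prime∣^⇒prime∣ x L pp p∣xᴸ)

no-coprime-solution : ∀ {n p x y z} → 1 < n → Prime p → Admissible n p z → 0 < x → 0 < y →
  NoCommonPrime x y → x ^ (2 * n) + y ^ (2 * n) ≢ z ^ (2 * n)
no-coprime-solution {n} 1<n pp adm x>0 y>0 x⊥y with 2 ∣? n
... | yes 2∣n = no-coprime-solution-4∣ (*-monoʳ-∣ 2 2∣n) x>0 y>0 x⊥y
... | no  2∤n = no-coprime-solution-odd 1<n 2∤n pp adm x>0 y>0 x⊥y

admissible⇒no-solution : ∀ {n p} → 1 < n → Prime p → ∀ z → Admissible n p z → ¬ PositiveSolution (2 * n) z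
admissible⇒no-solution {n} {p} 1<n pp = <-rec _ step
  where
  instance _ = m*n≢0 2 n {{_}} {{>-nonZero (<-trans z<s 1<n)}}
  step : ∀ z → (∀ {z′} → z′ < z → Admissible n p z′ → ¬ PositiveSolution (2 * n) z′) →
         Admissible n p z → ¬ PositiveSolution (2 * n) z
  step z rec adm sol = [ (λ x⊥y → no-coprime-solution 1<n pp adm x>0 y>0 x⊥y equation) , descend ]′
                         (noCommonPrime-or-commonPrime x y x>0)
    where
    open PositiveSolution sol
    descend : ∃[ q ] Prime q × q ∣ x × q ∣ y → ⊥
    descend (q , pq , q∣x , q∣y) =
      let (z′ , z′∣z , z′<z , sol′) = descent-common-prime sol pq q∣x q∣y in rec z′<z (Admissible-∣ {n} z′∣z adm) sol′

admissible-φ-divisors : ∀ {n p} s ps → Prime p → All (λ qe → φ-divisor (proj₁ qe) (2 * n)) ps →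
                        Admissible n p (p ^ s * prodPow ps)
admissible-φ-divisors {n} {p} s ps pp φps q pq q∣ with euclidsLemma (p ^ s) (prodPow ps) pq q∣
... | inj₁ q∣pˢ  = inj₁ (prime∣prime^⇒≡ s pp pq q∣pˢ)
... | inj₂ q∣ps = inj₂ (prodPow-factor ps φps q∣ps)
  where
  prodPow-factor : ∀ ps → All (λ qe → φ-divisor (proj₁ qe) (2 * n)) ps → q ∣ prodPow ps → (q ∸ 1) ∣ 2 * n
  prodPow-factor []              []          q∣1 = contradiction (∣1⇒≡1 q∣1) (>⇒≢ (prime⇒>1 pq))
  prodPow-factor ((q′ , e) ∷ ps) (φq′ ∷ φps) q∣ with euclidsLemma (q′ ^ e) (prodPow ps) pq q∣
  ... | inj₂ q∣ps   = prodPow-factor ps φps q∣ps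
  ... | inj₁ q∣q′ᵉ rewrite prime∣prime^⇒≡ e (proj₁ φq′) pq q∣q′ᵉ = φ-divisor⇒pred∣ φq′

admissible-2·3·p : ∀ {n p} s₁ s₂ s → Prime p → Admissible n p (2 ^ s₁ * 3 ^ s₂ * p ^ s)
admissible-2·3·p {n} s₁ s₂ s pp q pq q∣ with euclidsLemma (2 ^ s₁ * 3 ^ s₂) (_ ^ s) pq q∣
... | inj₂ q∣pˢ = inj₁ (prime∣prime^⇒≡ s pp pq q∣pˢ)
... | inj₁ q∣2ˢ3ˢ with euclidsLemma (2 ^ s₁) (3 ^ s₂) pq q∣2ˢ3ˢ
...   | inj₁ q∣2ˢ rewrite prime∣prime^⇒≡ s₁ prime[2] pq q∣2ˢ = inj₂ (1∣ (2 * n))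
...   | inj₂ q∣3ˢ rewrite prime∣prime^⇒≡ s₂ prime[3] pq q∣3ˢ = inj₂ (divides n (*-comm 2 n))

theorem13 : ((n : ℕ) → n > 1 → (p : ℕ) → Prime p → (s : ℕ) →
      (ps : List (ℕ × ℕ)) → All (λ q → φ-divisor (proj₁ q) (2 * n)) ps →
      (x₁ x₂ : ℕ) → x₁ > 0 → x₂ > 0 →
      ¬ (x₁ ^ (2 * n) + x₂ ^ (2 * n) ≡ (p ^ s * prodPow ps) ^ (2 * n)))
    ×
    ((n : ℕ) → n > 1 → (p : ℕ) → Prime p → (s₁ s₂ s : ℕ) →
      (x₁ x₂ : ℕ) → x₁ > 0 → x₂ > 0 →
      ¬ (x₁ ^ (2 * n) + x₂ ^ (2 * n) ≡ (2 ^ s₁ * 3 ^ s₂ * p ^ s) ^ (2 * n)))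
theorem13 =
  (λ n 1<n p pp s ps φps x₁ x₂ x₁>0 x₂>0 sol →
     admissible⇒no-solution 1<n pp _ (admissible-φ-divisors {n} s ps pp φps)
       record { x = x₁ ; y = x₂ ; x>0 = x₁>0 ; y>0 = x₂>0 ; equation = sol }) ,
  (λ n 1<n p pp s₁ s₂ s x₁ x₂ x₁>0 x₂>0 sol →
     admissible⇒no-solution 1<n pp _ (admissible-2·3·p {n} s₁ s₂ s pp)
       record { x = x₁ ; y = x₂ ; x>0 = x₁>0 ; y>0 = x₂>0 ; equation = sol })
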